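{- Let $s\geq 3$ and $t\geq 1$ be integers and let $G$ be the threshold graph realized by the code $0^{s}1^{t}$. Let $k\geq 2$ be the minimum number of isolated vertices taken from the independent part of $G$ such that $s\leq 2^{k}-1+k$ (i.e. the least integer $k\geq 2$ with $s\leq 2^k-1+k$). Then the threshold dimension of $G$ is $\tau(G)=t-1+k$.
   Context: Threshold graph realized by a binary code $b=b_1\cdots b_n$ (with $b_1=0$): start with a single vertex $v_1$; for $i\geq 2$ add $v_i$ as an isolated vertex if $b_i=0$ and as a dominating vertex (adjacent to all previously added vertices) if $b_i=1$. The code $0^s1^t$ is $s$ zeros followed by $t$ ones; its $s$ zero-vertices form the independent part. The metric dimension $\beta(H)$ of a connected graph $H$ is the minimum size of a set $\mathcal{W}$ of vertices such that every vertex is uniquely determined by its vector of distances to the vertices of $\mathcal{W}$. The threshold dimension is $\tau(G)=\min\{\beta(H): H \text{ contains } G \text{ as a spanning subgraph}\}$. -}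

module Defs where

open import Data.Nat using (ℕ; zero; suc; _+_; _≤_; _<ᵇ_)
open import Data.Bool using (Bool; true; false; _∧_; _∨_)
open import Data.Bool.Properties using (∨-comm; ∨-zeroʳ)
open import Data.Fin using (Fin; toℕ)
open import Data.Fin.Subset using (Subset; _∈_; ∣_∣)
open import Data.Vec using (Vec; lookup; replicate; _++_)
open import Data.Product using (Σ; ∃; _×_; _,_)
open import Relation.Binary.PropositionalEquality using (_≡_; refl)

record Graph (n : ℕ) : Set where
  field
    adj    : Fin n → Fin n → Bool
    sym    : ∀ u v → adj u v ≡ adj v u
    irrefl : ∀ u → adj u u ≡ false
open Graph public

_⊆ᴳ_ : ∀ {n} → Graph n → Graph n → Set
G ⊆ᴳ H = ∀ u v → adj G u v ≡ true → adj H u v ≡ true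

data Walk {n : ℕ} (H : Graph n) : Fin n → Fin n → ℕ → Set where
  here : ∀ {u} → Walk H u u 0
  step : ∀ {u v w ℓ} → adj H u v ≡ true → Walk H v w ℓ → Walk H u w (suc ℓ)

Connected : ∀ {n} → Graph n → Set
Connected H = ∀ u v → ∃ λ ℓ → Walk H u v ℓ

IsDist : ∀ {n} → Graph n → Fin n → Fin n → ℕ → Set
IsDist H u v d = Walk H u v d × (∀ m → Walk H u v m → d ≤ m)

Resolving : ∀ {n} → Graph n → Subset n → Set
Resolving H W = ∀ x y → (∀ w → w ∈ W → ∀ d → IsDist H x w d → IsDist H y w d) → x ≡ y

IsMetricDim : ∀ {n} → Graph n → ℕ → Set
IsMetricDim H b = (Σ (Subset _) λ W → Resolving H W × ∣ W ∣ ≡ b)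
                × (∀ W → Resolving H W → b ≤ ∣ W ∣)

IsThresholdDim : ∀ {n} → Graph n → ℕ → Set
IsThresholdDim {n} G τ =
  (Σ (Graph n) λ H → G ⊆ᴳ H × Connected H × IsMetricDim H τ)
  × (∀ (H : Graph n) b → G ⊆ᴳ H → Connected H → IsMetricDim H b → τ ≤ b)

-- Threshold graph realized by a binary code b (false = 0, true = 1):
-- for i < j, v_i ~ v_j iff b_j = 1.
private
  <ᵇ-irrefl : ∀ m → (m <ᵇ m) ≡ false
  <ᵇ-irrefl zero = refl
  <ᵇ-irrefl (suc m) = <ᵇ-irrefl m

thresholdAdj : ∀ {n} → Vec Bool n → Fin n → Fin n → Bool
thresholdAdj b i j = ((toℕ i <ᵇ toℕ j) ∧ lookup b j) ∨ ((toℕ j <ᵇ toℕ i) ∧ lookup b i)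

thresholdGraph : ∀ {n} → Vec Bool n → Graph n
thresholdGraph b = record
  { adj = thresholdAdj b
  ; sym = λ u v → ∨-comm ((toℕ u <ᵇ toℕ v) ∧ lookup b v) ((toℕ v <ᵇ toℕ u) ∧ lookup b u)
  ; irrefl = irr
  }
  where
  irr : ∀ u → thresholdAdj b u u ≡ false
  irr u rewrite <ᵇ-irrefl (toℕ u) = refl

code : (s t : ℕ) → Vec Bool (s + t)
code s t = replicate s false ++ replicate t true

-- The vertex s (the first 1 of the code) dominates every spanning supergraph H of G,
-- so distances in H are 0, 1 or 2 and a set W resolves H iff the vertices outside W
-- differ in their adjacencies to W.  The dominating vertices of G are adjacent to
-- everything, so at most one of them lies outside W, and outside W only the r
-- independent vertices of W separate: the s − r independent vertices outside W plus
-- that possible dominating one number at most 2 ^ r, and minimality of k turns this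
-- into ∣W∣ ≥ t − 1 + k.  Conversely, with W the first k independent vertices and all
-- dominating vertices but s, join each remaining independent vertex v to the vertex
-- i < k iff digit i of s − v is 0; distinct v then get distinct adjacencies to W.

module Submission where

open import Defs hiding (sym)
open import Data.Nat using (ℕ; zero; suc; _+_; _∸_; _^_; _≤_; _<_; z≤n; s≤s; _<ᵇ_; ⌊_/2⌋)
open import Data.Nat.Properties
open import Data.Bool using (Bool; true; false; _∧_; _∨_; not; if_then_else_)
open import Data.Bool.Properties using (∧-comm; ∨-comm; ∧-zeroʳ; ∨-zeroʳ; not-injective; T-≡)
open import Data.Fin using (Fin; zero; suc; toℕ; fromℕ<; _↑ʳ_)
open import Data.Fin.Properties using (toℕ-injective; toℕ-fromℕ<) renaming (_≟_ to _≟ᶠ_; suc-injective to suc-injectiveᶠ)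
open import Data.Fin.Subset using (Subset; ∣_∣; _∈_)
open import Data.Vec using (Vec; []; _∷_; lookup; tabulate; replicate)
open import Data.Vec.Properties using ([]=⇒lookup; lookup⇒[]=; lookup∘tabulate; lookup-replicate; lookup-++ʳ)
open import Data.Product using (_×_; _,_)
open import Data.Sum using (_⊎_; inj₁; inj₂)
open import Relation.Binary.Definitions using (tri<; tri≈; tri>)
open import Function using (_∘_; Equivalence)
open import Relation.Binary.PropositionalEquality
open import Relation.Nullary using (¬_; yes; no; contradiction)

∨-false : ∀ {a b} → a ∨ b ≡ false → a ≡ false × b ≡ false
∨-false {false} {false} refl = refl , refl

∧-elim : ∀ {a b} → a ∧ b ≡ true → a ≡ true × b ≡ true
∧-elim {true} refl = refl , refl

<⇒<ᵇ≡true : ∀ {m n} → m < n → (m <ᵇ n) ≡ true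
<⇒<ᵇ≡true m<n = Equivalence.to T-≡ (<⇒<ᵇ m<n)

≥⇒<ᵇ≡false : ∀ {m n} → n ≤ m → (m <ᵇ n) ≡ false
≥⇒<ᵇ≡false {m} {n} n≤m with m <ᵇ n in m<ᵇn
... | false = refl
... | true  = contradiction (<ᵇ⇒< m n (Equivalence.from T-≡ m<ᵇn)) (≤⇒≯ n≤m)

<ᵇ≡false⇒≥ : ∀ {m n} → (m <ᵇ n) ≡ false → n ≤ m
<ᵇ≡false⇒≥ m≮ᵇn = ≮⇒≥ λ m<n → contradiction (trans (sym m≮ᵇn) (<⇒<ᵇ≡true m<n)) λ ()

indicator : Bool → ℕ
indicator b = if b then 1 else 0

count : ∀ {m} → (Fin m → Bool) → ℕ
count {zero}  p = 0
count {suc m} p = indicator (p zero) + count (p ∘ suc)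

count-cong : ∀ {m} {p q : Fin m → Bool} → (∀ i → p i ≡ q i) → count p ≡ count q
count-cong {zero}  eq = refl
count-cong {suc m} eq = cong₂ _+_ (cong indicator (eq zero)) (count-cong (eq ∘ suc))

count-∧-comm : ∀ {m} (p q : Fin m → Bool) → count (λ i → p i ∧ q i) ≡ count (λ i → q i ∧ p i)
count-∧-comm p q = count-cong (λ i → ∧-comm (p i) (q i))

count-split : ∀ {m} (p q : Fin m → Bool) →
  count p ≡ count (λ i → p i ∧ q i) + count (λ i → p i ∧ not (q i))
count-split {zero} p q = refl
count-split {suc m} p q with p zero | q zero | count-split (p ∘ suc) (q ∘ suc)
... | true  | true  | ih = cong suc ih
... | true  | false | ih = trans (cong suc ih) (sym (+-suc _ _))
... | false | _     | ih = ih

count-false : ∀ {m} (p : Fin m → Bool) → (∀ i → p i ≡ false) → count p ≡ 0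
count-false {zero}  p none = refl
count-false {suc m} p none rewrite none zero = count-false (p ∘ suc) (none ∘ suc)

count-true : ∀ m → count {m} (λ _ → true) ≡ m
count-true zero    = refl
count-true (suc m) = cong suc (count-true m)

count≤1 : ∀ {m} (p : Fin m → Bool) →
  (∀ x y → p x ≡ true → p y ≡ true → x ≡ y) → count p ≤ 1
count≤1 {zero} p unique = z≤n
count≤1 {suc m} p unique with p zero in p0
... | false = count≤1 (p ∘ suc) (λ x y px py → suc-injectiveᶠ (unique (suc x) (suc y) px py))
... | true  = s≤s (≤-reflexive (count-false (p ∘ suc) only-zero))
  where
  only-zero : ∀ i → p (suc i) ≡ false
  only-zero i with p (suc i) in pi
  ... | false = refl
  ... | true  with () ← unique zero (suc i) p0 pi

∣_∣≡count : ∀ {n} (W : Subset n) → ∣ W ∣ ≡ count (lookup W)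
∣ []        ∣≡count = refl
∣ true  ∷ W ∣≡count = cong suc ∣ W ∣≡count
∣ false ∷ W ∣≡count = ∣ W ∣≡count

count≤2^count : ∀ {m n} (P : Fin m → Bool) (C : Fin n → Bool) (R : Fin m → Fin n → Bool) →
  (∀ x y → P x ≡ true → P y ≡ true → (∀ w → C w ≡ true → R x w ≡ R y w) → x ≡ y) →
  count P ≤ 2 ^ count C
count≤2^count {n = zero} P C R separated =
  count≤1 P (λ x y px py → separated x y px py (λ ()))
count≤2^count {m} {suc n} P C R separated with C zero in c₀
... | false = count≤2^count P (C ∘ suc) (λ x → R x ∘ suc) λ x y px py agree →
  separated x y px py λ where
    zero    cw → contradiction (trans (sym c₀) cw) λ ()
    (suc w) cw → agree w cw
... | true = begin
  count P
    ≡⟨ count-split P R₀ ⟩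
  count (λ x → P x ∧ R₀ x) + count (λ x → P x ∧ not (R₀ x))
    ≤⟨ +-mono-≤ (count≤2^count _ C′ R′ (separatedOn (λ e → e)))
                (count≤2^count _ C′ R′ (separatedOn not-injective)) ⟩
  2 ^ count C′ + 2 ^ count C′
    ≡⟨ cong (2 ^ count C′ +_) (sym (+-identityʳ _)) ⟩
  2 ^ suc (count C′) ∎
  where
  open ≤-Reasoning
  R₀ : Fin m → Bool
  R₀ x = R x zero
  C′ : Fin n → Bool
  C′ = C ∘ suc
  R′ : Fin m → Fin n → Bool
  R′ x = R x ∘ suc
  separatedOn : ∀ {β} {f : Bool → Bool} → (∀ {b} → f b ≡ true → b ≡ β) →
    ∀ x y → P x ∧ f (R₀ x) ≡ true → P y ∧ f (R₀ y) ≡ true →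
    (∀ w → C′ w ≡ true → R′ x w ≡ R′ y w) → x ≡ y
  separatedOn f⁻¹ x y px py agree with ∧-elim px | ∧-elim py
  ... | px′ , rx | py′ , ry = separated x y px′ py′ λ where
    zero    _  → trans (f⁻¹ rx) (sym (f⁻¹ ry))
    (suc w) cw → agree w cw

odd : ℕ → Bool
odd zero          = false
odd (suc zero)    = true
odd (suc (suc n)) = odd n

lowBit : ℕ → ℕ
lowBit n = indicator (odd n)

digit : ℕ → ℕ → Bool
digit n zero    = odd n
digit n (suc i) = digit ⌊ n /2⌋ i

digit-zero : ∀ i → digit 0 i ≡ false
digit-zero zero    = refl
digit-zero (suc i) = digit-zero i

lowBit+⌊n/2⌋+⌊n/2⌋≡n : ∀ n → lowBit n + (⌊ n /2⌋ + ⌊ n /2⌋) ≡ n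
lowBit+⌊n/2⌋+⌊n/2⌋≡n zero          = refl
lowBit+⌊n/2⌋+⌊n/2⌋≡n (suc zero)    = refl
lowBit+⌊n/2⌋+⌊n/2⌋≡n (suc (suc n)) = begin
  b + (suc h + suc h)   ≡⟨ cong (b +_) (cong suc (+-suc h h)) ⟩
  b + suc (suc (h + h)) ≡⟨ +-suc b (suc (h + h)) ⟩
  suc (b + suc (h + h)) ≡⟨ cong suc (+-suc b (h + h)) ⟩
  suc (suc (b + (h + h))) ≡⟨ cong (λ x → suc (suc x)) (lowBit+⌊n/2⌋+⌊n/2⌋≡n n) ⟩
  suc (suc n) ∎
  where
  open ≡-Reasoning
  b h : ℕ
  b = lowBit n
  h = ⌊ n /2⌋

n<2^[1+k]⇒⌊n/2⌋<2^k : ∀ n k → n < 2 ^ suc k → ⌊ n /2⌋ < 2 ^ k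
n<2^[1+k]⇒⌊n/2⌋<2^k n k n<2^1+k = ≰⇒> λ 2^k≤h → <⇒≱ n<2^1+k (begin
  2 ^ k + (2 ^ k + 0)            ≡⟨ cong (2 ^ k +_) (+-identityʳ _) ⟩
  2 ^ k + 2 ^ k                  ≤⟨ +-mono-≤ 2^k≤h 2^k≤h ⟩
  ⌊ n /2⌋ + ⌊ n /2⌋              ≤⟨ m≤n+m _ (lowBit n) ⟩
  lowBit n + (⌊ n /2⌋ + ⌊ n /2⌋) ≡⟨ lowBit+⌊n/2⌋+⌊n/2⌋≡n n ⟩
  n                              ∎)
  where open ≤-Reasoning

digits-injective : ∀ k {m n} → m < 2 ^ k → n < 2 ^ k →
  (∀ i → i < k → digit m i ≡ digit n i) → m ≡ n
digits-injective zero    {zero} {zero} _ _ _ = refl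
digits-injective zero    {suc m} (s≤s ())
digits-injective zero    {n = suc n} _ (s≤s ())
digits-injective (suc k) {m} {n} m< n< same = begin
  m                              ≡⟨ lowBit+⌊n/2⌋+⌊n/2⌋≡n m ⟨
  lowBit m + (⌊ m /2⌋ + ⌊ m /2⌋) ≡⟨ cong₂ (λ b h → indicator b + (h + h)) (same 0 (s≤s z≤n)) halves ⟩
  lowBit n + (⌊ n /2⌋ + ⌊ n /2⌋) ≡⟨ lowBit+⌊n/2⌋+⌊n/2⌋≡n n ⟩
  n                              ∎
  where
  open ≡-Reasoning
  halves : ⌊ m /2⌋ ≡ ⌊ n /2⌋
  halves = digits-injective k (n<2^[1+k]⇒⌊n/2⌋<2^k m k m<) (n<2^[1+k]⇒⌊n/2⌋<2^k n k n<) λ i i<k → same (suc i) (s≤s i<k)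

outside≢inside : ∀ {n} (W : Subset n) {x w} → lookup W x ≡ false → lookup W w ≡ true → x ≢ w
outside≢inside W x∉W w∈W refl = contradiction (trans (sym x∉W) w∈W) λ ()

module DominatingVertex {n} (H : Graph n) (c : Fin n)
  (c-dominates : ∀ v → c ≢ v → adj H c v ≡ true) where

  adjacent-to-c : ∀ u → u ≢ c → adj H u c ≡ true
  adjacent-to-c u u≢c = trans (Graph.sym H u c) (c-dominates u (u≢c ∘ sym))

  oneOrTwo : Bool → ℕ
  oneOrTwo b = if b then 1 else 2

  oneOrTwo-injective : ∀ {a b} → oneOrTwo a ≡ oneOrTwo b → a ≡ b
  oneOrTwo-injective {true}  {true}  _ = refl
  oneOrTwo-injective {false} {false} _ = refl

  distance : Fin n → Fin n → ℕ
  distance u v with u ≟ᶠ v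
  ... | yes _ = 0
  ... | no  _ = oneOrTwo (adj H u v)

  distance-refl : ∀ u → distance u u ≡ 0
  distance-refl u with u ≟ᶠ u
  ... | yes _   = refl
  ... | no  u≢u = contradiction refl u≢u

  distance-≢ : ∀ {u v} → u ≢ v → distance u v ≡ oneOrTwo (adj H u v)
  distance-≢ {u} {v} u≢v with u ≟ᶠ v
  ... | yes u≡v = contradiction u≡v u≢v
  ... | no  _   = refl

  distance≡0⇒≡ : ∀ {u v} → distance u v ≡ 0 → u ≡ v
  distance≡0⇒≡ {u} {v} d≡0 with u ≟ᶠ v
  ... | yes u≡v = u≡v
  ... | no  _ with adj H u v
  ...   | true  = contradiction d≡0 λ ()
  ...   | false = contradiction d≡0 λ ()

  distance-walk : ∀ u v → Walk H u v (distance u v)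
  distance-walk u v with u ≟ᶠ v
  ... | yes refl = here
  ... | no  u≢v with adj H u v in uv
  ...   | true  = step uv here
  ...   | false = step (adjacent-to-c u u≢c) (step (c-dominates v c≢v) here)
    where
    u≢c : u ≢ c
    u≢c refl = contradiction (trans (sym uv) (c-dominates v u≢v)) λ ()
    c≢v : c ≢ v
    c≢v refl = contradiction (trans (sym uv) (adjacent-to-c u u≢v)) λ ()

  distance-≤2 : ∀ u v → distance u v ≤ 2
  distance-≤2 u v with u ≟ᶠ v
  ... | yes _ = z≤n
  ... | no  _ with adj H u v
  ...   | true  = s≤s z≤n
  ...   | false = ≤-refl

  distance-minimal : ∀ u v ℓ → Walk H u v ℓ → distance u v ≤ ℓ
  distance-minimal u .u 0 here = ≤-reflexive (distance-refl u)
  distance-minimal u v 1 (step uv here) with u ≟ᶠ v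
  ... | yes _ = z≤n
  ... | no  _ rewrite uv = ≤-refl
  distance-minimal u v (suc (suc ℓ)) _ = ≤-trans (distance-≤2 u v) (s≤s (s≤s z≤n))

  isDist-distance : ∀ u v → IsDist H u v (distance u v)
  isDist-distance u v = distance-walk u v , distance-minimal u v

  isDist⇒≡distance : ∀ {u v d} → IsDist H u v d → d ≡ distance u v
  isDist⇒≡distance {u} {v} (walk , minimal) =
    ≤-antisym (minimal _ (distance-walk u v)) (distance-minimal u v _ walk)

  connected : Connected H
  connected u v = distance u v , distance-walk u v

  AdjacencyResolving : Subset n → Set
  AdjacencyResolving W = ∀ x y → lookup W x ≡ false → lookup W y ≡ false →
    (∀ w → lookup W w ≡ true → adj H x w ≡ adj H y w) → x ≡ y

  private
    distance-outside : ∀ (W : Subset n) {x w} → lookup W x ≡ false → lookup W w ≡ true →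
      distance x w ≡ oneOrTwo (adj H x w)
    distance-outside W x∉W w∈W = distance-≢ (outside≢inside W x∉W w∈W)

    distances-agree : ∀ W {x y} → (∀ w → w ∈ W → ∀ d → IsDist H x w d → IsDist H y w d) →
      ∀ w → lookup W w ≡ true → distance x w ≡ distance y w
    distances-agree W {x} same-dist w w∈W =
      isDist⇒≡distance (same-dist w (lookup⇒[]= w W w∈W) _ (isDist-distance x w))

  resolving⇒adjacencyResolving : ∀ {W} → Resolving H W → AdjacencyResolving W
  resolving⇒adjacencyResolving {W} resolving x y x∉W y∉W agree =
    resolving x y λ w w∈W d x-w → subst (IsDist H y w) (sym (begin
      d                    ≡⟨ isDist⇒≡distance x-w ⟩
      distance x w         ≡⟨ distance-outside W x∉W ([]=⇒lookup w∈W) ⟩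
      oneOrTwo (adj H x w) ≡⟨ cong oneOrTwo (agree w ([]=⇒lookup w∈W)) ⟩
      oneOrTwo (adj H y w) ≡⟨ distance-outside W y∉W ([]=⇒lookup w∈W) ⟨
      distance y w         ∎)) (isDist-distance y w)
    where open ≡-Reasoning

  adjacencyResolving⇒resolving : ∀ {W} → AdjacencyResolving W → Resolving H W
  adjacencyResolving⇒resolving {W} separated x y same-dist
    with lookup W x in xW | lookup W y in yW
  ... | true  | _    = sym (distance≡0⇒≡ (trans (sym (distances-agree W same-dist x xW)) (distance-refl x)))
  ... | false | true = distance≡0⇒≡ (trans (distances-agree W same-dist y yW) (distance-refl y))
  ... | false | false = separated x y xW yW λ w w∈W → oneOrTwo-injective (begin
      oneOrTwo (adj H x w) ≡⟨ distance-outside W xW w∈W ⟨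
      distance x w         ≡⟨ distances-agree W same-dist w w∈W ⟩
      distance y w         ≡⟨ distance-outside W yW w∈W ⟩
      oneOrTwo (adj H y w) ∎)
    where open ≡-Reasoning

edge⇒endpoint-in-ones : ∀ {n} (b : Vec Bool n) u v → adj (thresholdGraph b) u v ≡ true →
  lookup b u ≡ true ⊎ lookup b v ≡ true
edge⇒endpoint-in-ones b u v uv with lookup b u | lookup b v
... | true  | _    = inj₁ refl
... | false | true = inj₂ refl
... | false | false =
  contradiction (trans (sym (cong₂ _∨_ (∧-zeroʳ (toℕ u <ᵇ toℕ v)) (∧-zeroʳ (toℕ v <ᵇ toℕ u)))) uv) λ ()

code-monotone : ∀ s t {u v : Fin (s + t)} → toℕ u ≤ toℕ v →
  lookup (code s t) u ≡ true → lookup (code s t) v ≡ true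
code-monotone zero    t {v = v} _ _ = lookup-replicate v true
code-monotone (suc s) t {suc u} {suc v} (s≤s u≤v) bu = code-monotone s t u≤v bu

code-zeros : ∀ s t {v : Fin (s + t)} → toℕ v < s → lookup (code s t) v ≡ false
code-zeros (suc s) t {zero}  _         = refl
code-zeros (suc s) t {suc v} (s≤s v<s) = code-zeros s t v<s

code-ones : ∀ s t {v : Fin (s + t)} → s ≤ toℕ v → lookup (code s t) v ≡ true
code-ones zero    t {v}     _         = lookup-replicate v true
code-ones (suc s) t {suc v} (s≤s s≤v) = code-ones s t s≤v

ones-dominate : ∀ s t {u v : Fin (s + t)} → lookup (code s t) u ≡ true → u ≢ v →
  adj (thresholdGraph (code s t)) u v ≡ true
ones-dominate s t {u} {v} bu u≢v with <-cmp (toℕ u) (toℕ v)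
... | tri< u<v _ _
  rewrite <⇒<ᵇ≡true u<v | code-monotone s t (<⇒≤ u<v) bu = refl
... | tri≈ _ u≡v _ = contradiction (toℕ-injective u≡v) u≢v
... | tri> _ _ v<u
  rewrite ≥⇒<ᵇ≡false {toℕ u} {toℕ v} (<⇒≤ v<u) | <⇒<ᵇ≡true v<u | bu = refl

count-ones : ∀ s t → count (lookup (code s t)) ≡ t
count-ones zero    t = trans (count-cong {t} (λ i → lookup-replicate i true)) (count-true t)
count-ones (suc s) t = count-ones s t

count-zeros : ∀ s t → count (not ∘ lookup (code s t)) ≡ s
count-zeros zero    t = count-false {t} _ (λ i → cong not (lookup-replicate i true))
count-zeros (suc s) t = cong suc (count-zeros s t)

count-below-or-above : ∀ {t} k s → k ≤ s →
  count {s + suc t} (λ v → (toℕ v <ᵇ k) ∨ (s <ᵇ toℕ v)) ≡ t + k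
count-below-or-above {t} zero    zero    _         = trans (count-true t) (sym (+-identityʳ t))
count-below-or-above     zero    (suc s) _         = count-below-or-above zero s z≤n
count-below-or-above {t} (suc k) (suc s) (s≤s k≤s) =
  trans (cong suc (count-below-or-above k s k≤s)) (sym (+-suc t k))

3≤s⇒2≤j : ∀ {s j} → 3 ≤ s → s ≤ 2 ^ j ∸ 1 + j → 2 ≤ j
3≤s⇒2≤j {j = 0}           3≤s s≤ = contradiction (≤-trans 3≤s s≤) λ ()
3≤s⇒2≤j {j = 1}           3≤s s≤ = contradiction (≤-trans 3≤s s≤) λ { (s≤s (s≤s ())) }
3≤s⇒2≤j {j = suc (suc j)} _   _  = s≤s (s≤s z≤n)

least-solution : ∀ {s k} → 3 ≤ s →
  (∀ k′ → 2 ≤ k′ → k′ < k → ¬ (s ≤ 2 ^ k′ ∸ 1 + k′)) →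
  ∀ j → s ≤ 2 ^ j ∸ 1 + j → k ≤ j
least-solution 3≤s minimal j s≤ = ≮⇒≥ λ j<k → minimal j (3≤s⇒2≤j 3≤s s≤) j<k s≤

2^r≤2^[1+r]∸1 : ∀ r → 2 ^ r ≤ 2 ^ suc r ∸ 1
2^r≤2^[1+r]∸1 r = m+n≤o⇒m≤o∸n (2 ^ r) (+-monoʳ-≤ (2 ^ r) (≤-trans (m^n>0 2 r) (m≤m+n _ 0)))

-- r, q count the independent and dominating vertices of W; a, b those outside W.
count-bound⇒dimension-bound : ∀ {s t′ k r q a b} → 3 ≤ s →
  (∀ j → s ≤ 2 ^ j ∸ 1 + j → k ≤ j) →
  s ≡ r + a → suc t′ ≡ q + b → b + a ≤ 2 ^ r → b ≤ 1 → t′ + k ≤ q + r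
count-bound⇒dimension-bound {s} {t′} {k} {r} {q} {a} {zero} 3≤s least s≡ t≡ a≤ _ = begin
  t′ + k       ≤⟨ +-monoʳ-≤ t′ k≤1+r ⟩
  t′ + suc r   ≡⟨ +-suc t′ r ⟩
  suc t′ + r   ≡⟨ cong (_+ r) (trans t≡ (+-identityʳ q)) ⟩
  q + r        ∎
  where
  open ≤-Reasoning
  k≤1+r : k ≤ suc r
  k≤1+r = least (suc r) (begin
    s                      ≡⟨ s≡ ⟩
    r + a                  ≤⟨ +-monoʳ-≤ r a≤ ⟩
    r + 2 ^ r              ≤⟨ +-monoʳ-≤ r (2^r≤2^[1+r]∸1 r) ⟩
    r + (2 ^ suc r ∸ 1)    ≡⟨ +-comm r _ ⟩
    2 ^ suc r ∸ 1 + r      ≤⟨ +-monoʳ-≤ _ (n≤1+n r) ⟩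
    2 ^ suc r ∸ 1 + suc r  ∎)
count-bound⇒dimension-bound {s} {t′} {k} {r} {q} {a} {1} 3≤s least s≡ t≡ a<2^r _ = begin
  t′ + k  ≤⟨ +-monoʳ-≤ t′ k≤r ⟩
  t′ + r  ≡⟨ cong (_+ r) (suc-injective (trans t≡ (+-comm q 1))) ⟩
  q + r   ∎
  where
  open ≤-Reasoning
  k≤r : k ≤ r
  k≤r = least r (begin
    s               ≡⟨ s≡ ⟩
    r + a           ≤⟨ +-monoʳ-≤ r (<⇒≤pred a<2^r) ⟩
    r + (2 ^ r ∸ 1) ≡⟨ +-comm r _ ⟩
    2 ^ r ∸ 1 + r   ∎)
count-bound⇒dimension-bound {b = suc (suc _)} _ _ _ _ _ (s≤s ())

module SpanningSupergraph (s t′ : ℕ) (H : Graph (s + suc t′))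
  (G⊆H : thresholdGraph (code s (suc t′)) ⊆ᴳ H) where

  one : Fin (s + suc t′) → Bool
  one = lookup (code s (suc t′))

  one-adjacent : ∀ {u v} → one u ≡ true → u ≢ v → adj H u v ≡ true
  one-adjacent {u} {v} bu u≢v = G⊆H u v (ones-dominate s (suc t′) bu u≢v)

  adjacent-to-one : ∀ {u v} → one v ≡ true → u ≢ v → adj H u v ≡ true
  adjacent-to-one {u} {v} bv u≢v = trans (Graph.sym H u v) (one-adjacent bv (u≢v ∘ sym))

  open DominatingVertex H (s ↑ʳ zero)
    (λ _ → one-adjacent (lookup-++ʳ (replicate s false) (replicate (suc t′) true) zero))
    public

  module Cells (W : Subset (s + suc t′)) where

    inW : Fin (s + suc t′) → Bool
    inW = lookup W

    r q a b : ℕ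
    r = count (λ i → inW i ∧ not (one i))
    q = count (λ i → inW i ∧ one i)
    a = count (λ i → not (inW i) ∧ not (one i))
    b = count (λ i → not (inW i) ∧ one i)

    |W|≡q+r : ∣ W ∣ ≡ q + r
    |W|≡q+r = trans ∣ W ∣≡count (count-split inW one)

    s≡r+a : s ≡ r + a
    s≡r+a = begin
      s                 ≡⟨ count-zeros s (suc t′) ⟨
      count (not ∘ one) ≡⟨ count-split (not ∘ one) inW ⟩
      count (λ i → not (one i) ∧ inW i) + count (λ i → not (one i) ∧ not (inW i))
        ≡⟨ cong₂ _+_ (count-∧-comm (not ∘ one) inW) (count-∧-comm (not ∘ one) (not ∘ inW)) ⟩
      r + a             ∎
      where open ≡-Reasoning

    t≡q+b : suc t′ ≡ q + b
    t≡q+b = begin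
      suc t′    ≡⟨ count-ones s (suc t′) ⟨
      count one ≡⟨ count-split one inW ⟩
      count (λ i → one i ∧ inW i) + count (λ i → one i ∧ not (inW i))
        ≡⟨ cong₂ _+_ (count-∧-comm one inW) (count-∧-comm one (not ∘ inW)) ⟩
      q + b     ∎
      where open ≡-Reasoning

    agree-on-W : ∀ {x y} → inW x ≡ false → inW y ≡ false →
      (∀ w → inW w ∧ not (one w) ≡ true → adj H x w ≡ adj H y w) →
      ∀ w → inW w ≡ true → adj H x w ≡ adj H y w
    agree-on-W x∉W y∉W agree w w∈W with one w in bw
    ... | true  = trans (adjacent-to-one bw (outside≢inside W x∉W w∈W))
                        (sym (adjacent-to-one bw (outside≢inside W y∉W w∈W)))
    ... | false = agree w (cong₂ _∧_ w∈W (cong not bw))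

    b+a≤2^r : AdjacencyResolving W → b + a ≤ 2 ^ r
    b+a≤2^r separated = subst (_≤ 2 ^ r) (count-split (not ∘ inW) one)
      (count≤2^count (not ∘ inW) (λ w → inW w ∧ not (one w)) (adj H) λ x y x∉W y∉W agree →
        separated x y (not-injective x∉W) (not-injective y∉W)
          (agree-on-W (not-injective x∉W) (not-injective y∉W) agree))

    b≤1 : AdjacencyResolving W → b ≤ 1
    b≤1 separated = count≤1 _ λ x y xb yb → let x∉W , bx = ∧-elim xb ; y∉W , by = ∧-elim yb in
      separated x y (not-injective x∉W) (not-injective y∉W) λ w w∈W →
        trans (one-adjacent bx (outside≢inside W (not-injective x∉W) w∈W))
              (sym (one-adjacent by (outside≢inside W (not-injective y∉W) w∈W)))

  resolving-size : ∀ k → 3 ≤ s → (∀ j → s ≤ 2 ^ j ∸ 1 + j → k ≤ j) →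
    ∀ W → Resolving H W → t′ + k ≤ ∣ W ∣
  resolving-size k 3≤s least W resolving = subst (t′ + k ≤_) (sym |W|≡q+r)
    (count-bound⇒dimension-bound 3≤s least s≡r+a t≡q+b (b+a≤2^r separated) (b≤1 separated))
    where
    open Cells W
    separated : AdjacencyResolving W
    separated = resolving⇒adjacencyResolving resolving

module Construction (s t′ k : ℕ) (k≤s : k ≤ s) (s≤2^k∸1+k : s ≤ 2 ^ k ∸ 1 + k) where

  V : Set
  V = Fin (s + suc t′)

  one : V → Bool
  one = lookup (code s (suc t′))

  -- The dominating vertex s gets label s ∸ s = 0, consistent with its edges to all i < k.
  cross : V → V → Bool
  cross u v = (toℕ u <ᵇ k) ∧ not (toℕ v <ᵇ k) ∧ not (digit (s ∸ toℕ v) (toℕ u))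

  edge : V → V → Bool
  edge u v = (one u ∨ one v) ∨ (cross u v ∨ cross v u)

  adjacency : V → V → Bool
  adjacency u v with u ≟ᶠ v
  ... | yes _ = false
  ... | no  _ = edge u v

  adjacency-≢ : ∀ {u v} → u ≢ v → adjacency u v ≡ edge u v
  adjacency-≢ {u} {v} u≢v with u ≟ᶠ v
  ... | yes u≡v = contradiction u≡v u≢v
  ... | no  _   = refl

  adjacency-sym : ∀ u v → adjacency u v ≡ adjacency v u
  adjacency-sym u v with u ≟ᶠ v | v ≟ᶠ u
  ... | yes _   | yes _   = refl
  ... | no  _   | no  _   = cong₂ _∨_ (∨-comm (one u) (one v)) (∨-comm (cross u v) (cross v u))
  ... | yes u≡v | no  v≢u = contradiction (sym u≡v) v≢u
  ... | no  u≢v | yes v≡u = contradiction (sym v≡u) u≢v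

  adjacency-irrefl : ∀ u → adjacency u u ≡ false
  adjacency-irrefl u with u ≟ᶠ u
  ... | yes _   = refl
  ... | no  u≢u = contradiction refl u≢u

  H₀ : Graph (s + suc t′)
  H₀ = record { adj = adjacency ; sym = adjacency-sym ; irrefl = adjacency-irrefl }

  G⊆H₀ : thresholdGraph (code s (suc t′)) ⊆ᴳ H₀
  G⊆H₀ u v uv with u ≟ᶠ v
  ... | yes refl = contradiction (trans (sym (Graph.irrefl (thresholdGraph (code s (suc t′))) u)) uv) λ ()
  ... | no  _ with edge⇒endpoint-in-ones (code s (suc t′)) u v uv
  ...   | inj₁ bu rewrite bu = refl
  ...   | inj₂ bv rewrite bv | ∨-zeroʳ (one u) = refl

  inW₀ : V → Bool
  inW₀ v = (toℕ v <ᵇ k) ∨ (s <ᵇ toℕ v)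

  W₀ : Subset (s + suc t′)
  W₀ = tabulate inW₀

  ∣W₀∣ : ∣ W₀ ∣ ≡ t′ + k
  ∣W₀∣ = trans ∣ W₀ ∣≡count (trans (count-cong (lookup∘tabulate inW₀)) (count-below-or-above k s k≤s))

  outside-W₀ : ∀ {x : V} → lookup W₀ x ≡ false → k ≤ toℕ x × toℕ x ≤ s
  outside-W₀ {x} x∉W₀ with ∨-false (trans (sym (lookup∘tabulate inW₀ x)) x∉W₀)
  ... | x≮ᵇk , s≮ᵇx = <ᵇ≡false⇒≥ x≮ᵇk , <ᵇ≡false⇒≥ s≮ᵇx

  adjacency-digit : ∀ {x w} → k ≤ toℕ x → toℕ x ≤ s → toℕ w < k →
    adjacency x w ≡ not (digit (s ∸ toℕ x) (toℕ w))
  adjacency-digit {x} {w} k≤x x≤s w<k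
    rewrite adjacency-≢ {x} {w} (λ { refl → <⇒≱ w<k k≤x })
          | code-zeros s (suc t′) (<-≤-trans w<k k≤s)
          | ≥⇒<ᵇ≡false {toℕ x} {k} k≤x | <⇒<ᵇ≡true w<k
    with m≤n⇒m<n∨m≡n x≤s
  ... | inj₁ x<s rewrite code-zeros s (suc t′) x<s = refl
  ... | inj₂ x≡s rewrite code-ones s (suc t′) (≤-reflexive (sym x≡s)) | x≡s | n∸n≡0 s
                       | digit-zero (toℕ w) = refl

  code<2^k : ∀ {x : V} → k ≤ toℕ x → s ∸ toℕ x < 2 ^ k
  code<2^k {x} k≤x = ≤-<-trans (begin
    s ∸ toℕ x             ≤⟨ ∸-monoʳ-≤ s k≤x ⟩
    s ∸ k                 ≤⟨ ∸-monoˡ-≤ k s≤2^k∸1+k ⟩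
    2 ^ k ∸ 1 + k ∸ k     ≡⟨ m+n∸n≡m _ k ⟩
    2 ^ k ∸ 1             ∎) (∸-monoʳ-< {2 ^ k} {1} {0} (s≤s z≤n) (m^n>0 2 k))
    where open ≤-Reasoning

  vertex : ∀ {i} → i < k → V
  vertex i<k = fromℕ< (<-≤-trans i<k (≤-trans k≤s (m≤m+n s (suc t′))))

  toℕ-vertex : ∀ {i} (i<k : i < k) → toℕ (vertex i<k) ≡ i
  toℕ-vertex i<k = toℕ-fromℕ< _

  vertex∈W₀ : ∀ {i} (i<k : i < k) → lookup W₀ (vertex i<k) ≡ true
  vertex∈W₀ {i} i<k = begin
    lookup W₀ (vertex i<k) ≡⟨ lookup∘tabulate inW₀ (vertex i<k) ⟩
    inW₀ (vertex i<k)      ≡⟨ cong (λ j → (j <ᵇ k) ∨ (s <ᵇ j)) (toℕ-vertex i<k) ⟩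
    (i <ᵇ k) ∨ (s <ᵇ i)    ≡⟨ cong (_∨ (s <ᵇ i)) (<⇒<ᵇ≡true i<k) ⟩
    true                   ∎
    where open ≡-Reasoning

  W₀-adjacencyResolving : SpanningSupergraph.AdjacencyResolving s t′ H₀ G⊆H₀ W₀
  W₀-adjacencyResolving x y x∉W₀ y∉W₀ agree
    with outside-W₀ x∉W₀ | outside-W₀ y∉W₀
  ... | k≤x , x≤s | k≤y , y≤s =
    toℕ-injective (∸-cancelˡ-≡ x≤s y≤s
      (digits-injective k (code<2^k k≤x) (code<2^k k≤y) same-digits))
    where
    same-digits : ∀ i → i < k → digit (s ∸ toℕ x) i ≡ digit (s ∸ toℕ y) i
    same-digits i i<k = subst (λ j → digit (s ∸ toℕ x) j ≡ digit (s ∸ toℕ y) j) (toℕ-vertex i<k)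
      (not-injective (begin
        not (digit (s ∸ toℕ x) (toℕ w)) ≡⟨ adjacency-digit k≤x x≤s w<k ⟨
        adjacency x w                   ≡⟨ agree w (vertex∈W₀ i<k) ⟩
        adjacency y w                   ≡⟨ adjacency-digit k≤y y≤s w<k ⟩
        not (digit (s ∸ toℕ y) (toℕ w)) ∎))
      where
      open ≡-Reasoning
      w : V
      w = vertex i<k
      w<k : toℕ w < k
      w<k = subst (_< k) (sym (toℕ-vertex i<k)) i<k

lemma3p1 : (s t : ℕ) → 3 ≤ s → 1 ≤ t →
    (k : ℕ) → 2 ≤ k → s ≤ 2 ^ k ∸ 1 + k →
    (∀ k′ → 2 ≤ k′ → k′ < k → ¬ (s ≤ 2 ^ k′ ∸ 1 + k′)) →
    IsThresholdDim (thresholdGraph (code s t)) (t ∸ 1 + k)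
-- The hypothesis 2 ≤ k is unused: it already follows from 3 ≤ s ≤ 2 ^ k ∸ 1 + k.
lemma3p1 s zero    _   () _ _ _ _
lemma3p1 s (suc t′) 3≤s _ k _ s≤2^k∸1+k minimal =
  (H₀ , G⊆H₀ , S₀.connected , (W₀ , W₀-resolving , ∣W₀∣) , S₀.resolving-size k 3≤s least) ,
  λ H b G⊆H _ ((W , W-resolving , ∣W∣≡b) , _) →
    subst (t′ + k ≤_) ∣W∣≡b (SpanningSupergraph.resolving-size s t′ H G⊆H k 3≤s least W W-resolving)
  where
  least : ∀ j → s ≤ 2 ^ j ∸ 1 + j → k ≤ j
  least = least-solution 3≤s minimal
  open Construction s t′ k (least s (m≤n+m s _)) s≤2^k∸1+k
  module S₀ = SpanningSupergraph s t′ H₀ G⊆H₀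
  W₀-resolving : Resolving H₀ W₀
  W₀-resolving = S₀.adjacencyResolving⇒resolving W₀-adjacencyResolving
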